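{- Let $n\geq 1$ and $t\geq 2$ be integers. There exists a perfect matching $F$ of $K_{2n}$ such that $\ell(F)=\left\{2^t,4^t,\ldots,\left(\frac{2n}{t}\right)^t\right\}$ (the list of $n$ elements in which each even integer from $2$ to $\frac{2n}{t}$ appears exactly $t$ times) if and only if $n\equiv 0\pmod s$, where $s=t$ if $t$ is even and $s=4t$ if $t$ is odd.
   Context: For a positive integer $v$, $K_v$ denotes the complete graph on the vertex set $\{0,1,\ldots,v-1\}$. The length of an edge $\{u,w\}$ of $K_v$ is $\ell(u,w)=\min(|u-w|,\,v-|u-w|)$. For a subgraph $\Gamma$ of $K_v$, $\ell(\Gamma)$ is the list (multiset) of lengths of all edges of $\Gamma$, counted with multiplicity. A perfect matching of $K_{2n}$ is a set of $n$ pairwise disjoint edges covering all vertices. The notation $\{z_1^{e_1},\ldots,z_k^{e_k}\}$ denotes the list containing $e_i$ copies of $z_i$. -}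

module Defs where

open import Data.Nat using (ℕ; zero; suc; _+_; _*_; _∸_; _<_; _⊓_; _/_; _%_)
open import Data.Nat.Divisibility using (_∣_)
open import Data.Product using (_×_; _,_; proj₁; proj₂; ∃)
open import Data.List using (List; []; _∷_; length; map; concatMap; replicate; upTo)
open import Data.List.Membership.Propositional using (_∈_)
open import Data.List.Relation.Unary.All using (All)
open import Data.List.Relation.Unary.Unique.Propositional using (Unique)
open import Data.List.Relation.Binary.Permutation.Propositional using (_↭_)
open import Relation.Binary.PropositionalEquality using (_≡_; _≢_)

-- An edge of K_v is an unordered pair {u , w}; represented by a pair (u , w).
Edge : Set
Edge = ℕ × ℕ

absDiff : ℕ → ℕ → ℕ
absDiff u w = (u ∸ w) + (w ∸ u)

edgeLength : ℕ → Edge → ℕ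
edgeLength v (u , w) = absDiff u w ⊓ (v ∸ absDiff u w)

lengths : ℕ → List Edge → List ℕ
lengths v Γ = map (edgeLength v) Γ

IsEdge : ℕ → Edge → Set
IsEdge v (u , w) = u < v × w < v × u ≢ w

endpoints : List Edge → List ℕ
endpoints [] = []
endpoints ((u , w) ∷ F) = u ∷ w ∷ endpoints F

-- Pairwise disjointness (and distinctness of the
-- edges) is expressed by the list of all endpoints having no repetitions.
IsPerfectMatching : ℕ → List Edge → Set
IsPerfectMatching n F =
  All (IsEdge (2 * n)) F
  × length F ≡ n
  × Unique (endpoints F)
  × (∀ x → x < 2 * n → x ∈ endpoints F)

evenList : ℕ → ℕ → List ℕ
evenList t m = concatMap (λ i → replicate t (2 * suc i)) (upTo m)

-- the list {2^t, 4^t, …, (2n/t)^t} (meaningful when t ∣ n): the even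
-- integers 2,…,2n/t, i.e. 2·i for i = 1,…,n/t, each repeated t times
targetList : ℕ → ℕ → List ℕ
targetList zero n = []
targetList (suc k) n = evenList (suc k) (n / suc k)

sOf : ℕ → ℕ
sOf t with t % 2
... | zero = t
... | suc _ = 4 * t

module Submission where

-- Two perfect matchings of the path 0, 1, …, n - 1 with path distances (gaps) D₁ and D₂,
-- placed on the even and on the odd vertices of K_2n, form a perfect matching of K_2n whose lengths are
-- twice the gaps, provided every gap d satisfies 2d ≤ n.  With n = mt it therefore suffices to split t
-- copies of {1, …, m} into the gap lists of two such path matchings.  k edges nested around an empty
-- (resp. a one-vertex) block have the odd (resp. even) gaps below 2k, and gluing nested blocks and joining
-- leftover points realises two copies of {1, …, m} on two paths of length 2m.  For odd t one more copy is
-- needed: three copies on two paths of length 3m, one of which carries a Skolem sequence of order m; we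
-- build one for every m divisible by 4.
--
-- If all lengths are even, every edge joins vertices of equal parity, so the n odd vertices are
-- matched among themselves and n is even.  Then for each edge {u, w} of length ℓ the number
-- ⌊u/2⌋ + ⌊w/2⌋ + ℓ/2 is even; summed over F, and since the ⌊x/2⌋ of all vertices sum to n(n - 1),
-- the half-lengths t·m(m + 1)/2 sum to an even number.  For odd t this forces m even and then 4 ∣ m.

open import Defs
open import Data.Empty using (⊥-elim)
open import Data.List using (List; []; _∷_; _++_; [_]; length; map; concat; replicate; upTo; applyDownFrom)
open import Data.List.Properties
  using (map-++; map-∘; map-cong; map-id; map-upTo; upTo-∷ʳ; ++-assoc; ++-identityʳ; length-upTo; concat-++; map-replicate)
open import Data.List.Membership.Propositional using (_∈_)
open import Data.List.Membership.Propositional.Properties using (∈-upTo⁺; ∈-upTo⁻; ∈-∃++)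
open import Data.List.Relation.Unary.All as All using (All; []; _∷_)
import Data.List.Relation.Unary.All.Properties as All
open import Data.List.Relation.Unary.AllPairs as AllPairs using ([]; _∷_)
open import Data.List.Relation.Unary.Any using (here; there)
open import Data.List.Relation.Unary.Unique.Propositional using (Unique)
open import Data.List.Relation.Unary.Unique.Propositional.Properties using (upTo⁺)
open import Data.List.Relation.Binary.Permutation.Propositional
  using (_↭_; prep; swap; ↭-refl; ↭-sym; ↭-trans; ↭-reflexive; ↭⇒↭ₛ; module PermutationReasoning)
open import Data.List.Relation.Binary.Permutation.Propositional.Properties
  using (++⁺ˡ; ++⁺ʳ; ++⁺; shift; shifts; ∷↭∷ʳ; map⁺; ++-comm; ↭-length; ∈-resp-↭; All-resp-↭)
import Data.List.Relation.Binary.Permutation.Setoid.Properties as SetoidPermutation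
open import Data.Nat using (ℕ; zero; suc; _+_; _*_; _∸_; _≤_; _<_; _⊓_; _/_; _%_; z≤n; s≤s; ⌊_/2⌋)
open import Data.Nat.Properties
open import Data.Nat.Divisibility using (_∣_; divides; ∣m+n∣m⇒∣n; ∣m∣n⇒∣m+n; *-monoˡ-∣)
open import Data.Nat.DivMod using (m*n/n≡m; m*n%n≡0; [m+kn]%n≡m%n)
open import Data.Nat.ListAction using (sum)
open import Data.Nat.ListAction.Properties using (sum-++; sum-↭)
open import Data.Nat.Tactic.RingSolver using (solve-∀)
open import Data.Product using (_×_; _,_; proj₂; Σ)
open import Data.Sum using (_⊎_; inj₁; inj₂)
open import Function.Base using (_∘_)
open import Function.Bundles using (_⇔_; mk⇔; Equivalence)
open import Relation.Binary.PropositionalEquality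
  using (_≡_; refl; sym; trans; cong; cong₂; subst; subst₂; setoid; module ≡-Reasoning)

n+n≡n*2 : ∀ n → n + n ≡ n * 2
n+n≡n*2 = solve-∀

upTo-suc : ∀ n → upTo (suc n) ≡ 0 ∷ map suc (upTo n)
upTo-suc n = cong (0 ∷_) (sym (map-upTo suc n))

upTo-+ : ∀ a b → upTo (a + b) ≡ upTo a ++ map (a +_) (upTo b)
upTo-+ zero b = sym (map-id (upTo b))
upTo-+ (suc a) b = begin
  upTo (suc (a + b))                                       ≡⟨ upTo-suc (a + b) ⟩
  0 ∷ map suc (upTo (a + b))                               ≡⟨ cong (λ xs → 0 ∷ map suc xs) (upTo-+ a b) ⟩
  0 ∷ map suc (upTo a ++ map (a +_) (upTo b))              ≡⟨ cong (0 ∷_) (map-++ suc (upTo a) _) ⟩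
  0 ∷ (map suc (upTo a) ++ map suc (map (a +_) (upTo b)))  ≡⟨ cong (λ xs → 0 ∷ (map suc (upTo a) ++ xs)) (map-∘ (upTo b)) ⟨
  0 ∷ (map suc (upTo a) ++ map (suc a +_) (upTo b))        ≡⟨ cong (_++ map (suc a +_) (upTo b)) (sym (upTo-suc a)) ⟩
  upTo (suc a) ++ map (suc a +_) (upTo b)                  ∎
  where open ≡-Reasoning

upTo-2*suc : ∀ n → upTo (2 * suc n) ≡ upTo (2 * n) ++ 2 * n ∷ suc (2 * n) ∷ []
upTo-2*suc n = begin
  upTo (2 * suc n)                            ≡⟨ cong upTo (trans (*-suc 2 n) (+-comm 2 (2 * n))) ⟩
  upTo (2 * n + 2)                            ≡⟨ upTo-+ (2 * n) 2 ⟩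
  upTo (2 * n) ++ 2 * n + 0 ∷ 2 * n + 1 ∷ []  ≡⟨ cong (λ xs → upTo (2 * n) ++ xs)
                                                      (cong₂ (λ x y → x ∷ y ∷ []) (+-identityʳ (2 * n)) (+-comm (2 * n) 1)) ⟩
  upTo (2 * n) ++ 2 * n ∷ suc (2 * n) ∷ []    ∎
  where open ≡-Reasoning

++-interchange : ∀ (ws xs ys zs : List ℕ) → (ws ++ xs) ++ (ys ++ zs) ↭ (ws ++ ys) ++ (xs ++ zs)
++-interchange ws xs ys zs = begin
  (ws ++ xs) ++ (ys ++ zs)  ≡⟨ ++-assoc ws xs (ys ++ zs) ⟩
  ws ++ (xs ++ (ys ++ zs))  ↭⟨ ++⁺ˡ ws (shifts xs ys) ⟩
  ws ++ (ys ++ (xs ++ zs))  ≡⟨ ++-assoc ws ys (xs ++ zs) ⟨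
  (ws ++ ys) ++ (xs ++ zs)  ∎
  where open PermutationReasoning

upTo-2* : ∀ n → upTo (2 * n) ↭ map (2 *_) (upTo n) ++ map (suc ∘ (2 *_)) (upTo n)
upTo-2* zero = ↭-refl
upTo-2* (suc n) = begin
  upTo (2 * suc n)                         ≡⟨ upTo-2*suc n ⟩
  upTo k ++ ([ k ] ++ [ suc k ])           ↭⟨ ++⁺ʳ _ (upTo-2* n) ⟩
  (Ev ++ Od) ++ ([ k ] ++ [ suc k ])       ↭⟨ ++-interchange Ev Od [ k ] [ suc k ] ⟩
  (Ev ++ [ k ]) ++ (Od ++ [ suc k ])       ≡⟨ cong₂ _++_ (map-++ (2 *_) (upTo n) [ n ]) (map-++ (suc ∘ (2 *_)) (upTo n) [ n ]) ⟨
  map (2 *_) (upTo n ++ [ n ]) ++ map (suc ∘ (2 *_)) (upTo n ++ [ n ])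
                                           ≡⟨ cong (λ xs → map (2 *_) xs ++ map (suc ∘ (2 *_)) xs) (upTo-∷ʳ n) ⟩
  map (2 *_) (upTo (suc n)) ++ map (suc ∘ (2 *_)) (upTo (suc n)) ∎
  where
  open PermutationReasoning
  k = 2 * n
  Ev = map (2 *_) (upTo n)
  Od = map (suc ∘ (2 *_)) (upTo n)

positives : ℕ → List ℕ
positives = applyDownFrom suc

-- c + 2k - 1, …, c + 3, c + 1: the gaps of k edges nested around a block of c vertices
nestGaps : ℕ → ℕ → List ℕ
nestGaps k c = applyDownFrom (λ i → c + suc (i * 2)) k

odds evens : ℕ → List ℕ
odds k = nestGaps k 0
evens k = nestGaps k 1

nestGaps-+ : ∀ a b c → nestGaps (a + b) c ≡ nestGaps a (c + b * 2) ++ nestGaps b c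
nestGaps-+ zero b c = refl
nestGaps-+ (suc a) b c = cong₂ _∷_ (outermost a b c) (nestGaps-+ a b c)
  where
  outermost : ∀ a b c → c + suc ((a + b) * 2) ≡ c + b * 2 + suc (a * 2)
  outermost = solve-∀

evens++odds : ∀ h → evens h ++ odds h ↭ positives (h * 2)
odds++evens : ∀ h → odds (suc h) ++ evens h ↭ positives (suc (h * 2))
evens++odds zero = ↭-refl
evens++odds (suc h) = prep _ (↭-trans (++-comm (evens h) (odds (suc h))) (odds++evens h))
odds++evens h = prep _ (↭-trans (++-comm (odds h) (evens h)) (evens++odds h))

copies : ℕ → List ℕ → List ℕ
copies k xs = concat (replicate k xs)

copies-+ : ∀ i j xs → copies (i + j) xs ≡ copies i xs ++ copies j xs
copies-+ zero j xs = refl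
copies-+ (suc i) j xs = trans (cong (xs ++_) (copies-+ i j xs)) (sym (++-assoc xs _ _))

copies-* : ∀ i j xs → copies (i * j) xs ≡ copies i (copies j xs)
copies-* zero j xs = refl
copies-* (suc i) j xs = trans (copies-+ j (i * j) xs) (cong (copies j xs ++_) (copies-* i j xs))

copies-[] : ∀ t → copies t [] ≡ []
copies-[] zero = refl
copies-[] (suc t) = copies-[] t

copies-∷ : ∀ t x xs → copies t (x ∷ xs) ↭ replicate t x ++ copies t xs
copies-∷ zero x xs = ↭-refl
copies-∷ (suc t) x xs = prep x (↭-trans (++⁺ˡ xs (copies-∷ t x xs)) (shifts xs (replicate t x)))

copies-bounded : ∀ t m → All (_≤ m) (copies t (positives m))
copies-bounded t m = All.concat⁺ (All.replicate⁺ t (All.applyDownFrom⁺₁ suc m (λ i<m → i<m)))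

data Parity : ℕ → Set where
  even : ∀ h → Parity (h * 2)
  odd  : ∀ h → Parity (suc (h * 2))

parity : ∀ m → Parity m
parity zero = even 0
parity (suc m) with parity m
... | even h = odd h
... | odd h = even (suc h)

mapEdge : (ℕ → ℕ) → Edge → Edge
mapEdge f (u , w) = f u , f w

gap : Edge → ℕ
gap (u , w) = absDiff u w

absDiff-+ˡ : ∀ k u w → absDiff (k + u) (k + w) ≡ absDiff u w
absDiff-+ˡ zero u w = refl
absDiff-+ˡ (suc k) u w = absDiff-+ˡ k u w

absDiff-+ʳ : ∀ u c → absDiff u (c + u) ≡ c
absDiff-+ʳ u c = cong₂ _+_ (m≤n⇒m∸n≡0 (m≤n+m u c)) (m+n∸n≡m c u)

absDiff-comm : ∀ u w → absDiff u w ≡ absDiff w u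
absDiff-comm u w = +-comm (u ∸ w) (w ∸ u)

gaps-shift : ∀ k F → map gap (map (mapEdge (k +_)) F) ≡ map gap F
gaps-shift k F = trans (sym (map-∘ F)) (map-cong (λ (u , w) → absDiff-+ˡ k u w) F)

gap-double : ∀ e → gap (mapEdge (2 *_) e) ≡ 2 * gap e
gap-double (u , w) =
  sym (trans (*-distribˡ-+ 2 (u ∸ w) (w ∸ u)) (cong₂ _+_ (*-distribˡ-∸ 2 u w) (*-distribˡ-∸ 2 w u)))

-- absDiff (suc x) (suc y) reduces to absDiff x y
gap-doubleSuc : ∀ e → gap (mapEdge (suc ∘ (2 *_)) e) ≡ 2 * gap e
gap-doubleSuc = gap-double

endpoints-++ : ∀ F G → endpoints (F ++ G) ≡ endpoints F ++ endpoints G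
endpoints-++ [] G = refl
endpoints-++ ((u , w) ∷ F) G = cong (λ xs → u ∷ w ∷ xs) (endpoints-++ F G)

endpoints-map : ∀ f F → endpoints (map (mapEdge f) F) ≡ map f (endpoints F)
endpoints-map f [] = refl
endpoints-map f ((u , w) ∷ F) = cong (λ xs → f u ∷ f w ∷ xs) (endpoints-map f F)

-- Matchings of a path

-- A matching of the path 0, 1, …, size - 1 leaving exactly the vertices in loose unmatched; the gaps are
-- the path distances |u - w| of its edges, not their lengths in a cycle.
record PathMatching (size : ℕ) (gaps loose : List ℕ) : Set where
  constructor pathMatching
  field
    edges  : List Edge
    covers : endpoints edges ++ loose ↭ upTo size
    gaps↭  : map gap edges ↭ gaps

castPM : ∀ {a b D E P Q} → a ≡ b → D ↭ E → P ↭ Q → PathMatching a D P → PathMatching b E Q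
castPM refl D↭E P↭Q (pathMatching F cov gs) =
  pathMatching F (↭-trans (++⁺ˡ (endpoints F) (↭-sym P↭Q)) cov) (↭-trans gs D↭E)

resize : ∀ {a b D P} → a ≡ b → PathMatching a D P → PathMatching b D P
resize a≡b = castPM a≡b ↭-refl ↭-refl

emptyPM : PathMatching 0 [] []
emptyPM = pathMatching [] ↭-refl ↭-refl

pointPM : PathMatching 1 [] [ 0 ]
pointPM = pathMatching [] ↭-refl ↭-refl

infixr 5 _⊕_

_⊕_ : ∀ {a b D E P Q} → PathMatching a D P → PathMatching b E Q → PathMatching (a + b) (D ++ E) (P ++ map (a +_) Q)
_⊕_ {a} {b} {P = P} {Q = Q} (pathMatching F covF gsF) (pathMatching G covG gsG) =
  pathMatching (F ++ map (mapEdge (a +_)) G) covers gaps↭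
  where
  covers : endpoints (F ++ map (mapEdge (a +_)) G) ++ (P ++ map (a +_) Q) ↭ upTo (a + b)
  covers = begin
    endpoints (F ++ map (mapEdge (a +_)) G) ++ (P ++ map (a +_) Q)
      ≡⟨ cong (_++ (P ++ map (a +_) Q)) (trans (endpoints-++ F _) (cong (endpoints F ++_) (endpoints-map (a +_) G))) ⟩
    (endpoints F ++ map (a +_) (endpoints G)) ++ (P ++ map (a +_) Q)
      ↭⟨ ++-interchange (endpoints F) _ P _ ⟩
    (endpoints F ++ P) ++ (map (a +_) (endpoints G) ++ map (a +_) Q)
      ≡⟨ cong ((endpoints F ++ P) ++_) (map-++ (a +_) (endpoints G) Q) ⟨
    (endpoints F ++ P) ++ map (a +_) (endpoints G ++ Q)
      ↭⟨ ++⁺ covF (map⁺ (a +_) covG) ⟩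
    upTo a ++ map (a +_) (upTo b)
      ≡⟨ upTo-+ a b ⟨
    upTo (a + b) ∎
    where open PermutationReasoning
  gaps↭ : map gap (F ++ map (mapEdge (a +_)) G) ↭ _
  gaps↭ = ↭-trans (↭-reflexive (trans (map-++ gap F _) (cong (map gap F ++_) (gaps-shift a G)))) (++⁺ gsF gsG)

join : ∀ {a D P p q Q} → P ↭ p ∷ q ∷ Q → PathMatching a D P → PathMatching a (absDiff p q ∷ D) Q
join {a} {P = P} {p} {q} {Q} P↭ (pathMatching F cov gs) = pathMatching ((p , q) ∷ F) covers (prep _ gs)
  where
  covers : p ∷ q ∷ endpoints F ++ Q ↭ upTo a
  covers = begin
    (p ∷ q ∷ []) ++ endpoints F ++ Q  ↭⟨ shifts (p ∷ q ∷ []) (endpoints F) ⟩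
    endpoints F ++ p ∷ q ∷ Q          ↭⟨ ++⁺ˡ (endpoints F) (↭-sym P↭) ⟩
    endpoints F ++ P                  ↭⟨ cov ⟩
    upTo a                            ∎
    where open PermutationReasoning

enclose : ∀ {a D P} → PathMatching a D P → PathMatching (2 + a) (suc a ∷ D) (map suc P)
enclose {a} {D} {P} X = castPM size (↭-reflexive gaps) ↭-refl (join loose (pointPM ⊕ X ⊕ pointPM))
  where
  size : 1 + (a + 1) ≡ 2 + a
  size = cong suc (+-comm a 1)
  gaps : suc (a + 0) ∷ (D ++ []) ≡ suc a ∷ D
  gaps = cong₂ _∷_ (cong suc (+-identityʳ a)) (++-identityʳ D)
  loose : 0 ∷ map suc (P ++ [ a + 0 ]) ↭ 0 ∷ suc (a + 0) ∷ map suc P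
  loose = prep 0 (↭-trans (↭-reflexive (map-++ suc P _)) (↭-sym (∷↭∷ʳ _ (map suc P))))

encloseⁿ : ∀ {a D P} k → PathMatching a D P → PathMatching (k * 2 + a) (nestGaps k a ++ D) (map (k +_) P)
encloseⁿ zero X = castPM refl ↭-refl (↭-reflexive (sym (map-id _))) X
encloseⁿ {a} {D} {P} (suc k) X =
  castPM refl (↭-reflexive (cong (_∷ nestGaps k a ++ D) (outer-gap k a))) (↭-reflexive (sym (map-∘ P)))
    (enclose (encloseⁿ k X))
  where
  outer-gap : ∀ k a → suc (k * 2 + a) ≡ a + suc (k * 2)
  outer-gap = solve-∀

nested : ∀ k → PathMatching (k * 2) (odds k) []
nested k = castPM (+-identityʳ (k * 2)) (↭-reflexive (++-identityʳ (odds k))) ↭-refl (encloseⁿ k emptyPM)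

nestedAround : ∀ k → PathMatching (suc (k * 2)) (evens k) [ k ]
nestedAround k =
  castPM (+-comm (k * 2) 1) (↭-reflexive (++-identityʳ (evens k))) (↭-reflexive (cong [_] (+-identityʳ k)))
    (encloseⁿ k pointPM)

bridged : ∀ a b → PathMatching (suc (a * 2) + suc (b * 2)) (suc (a + b) ∷ evens a ++ evens b) []
bridged a b =
  castPM refl (↭-reflexive (cong (_∷ evens a ++ evens b) bridge-gap)) ↭-refl (join ↭-refl (nestedAround a ⊕ nestedAround b))
  where
  split : ∀ a b → suc (a * 2) + b ≡ suc (a + b) + a
  split = solve-∀
  bridge-gap : absDiff a (suc (a * 2) + b) ≡ suc (a + b)
  bridge-gap = trans (cong (absDiff a) (split a b)) (absDiff-+ʳ a (suc (a + b)))

-- A Skolem sequence of order 4 (s + 1): the pairs of equal entries are the edges.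
skolem : ∀ s → PathMatching (suc s * 4 * 2) (positives (suc s * 4)) []
skolem zero = castPM refl order4 ↭-refl (enclose emptyPM ⊕ join ↭-refl (nestedAround 2 ⊕ pointPM))
  where
  order4 : 1 ∷ 3 ∷ 4 ∷ 2 ∷ [] ↭ 4 ∷ 3 ∷ 2 ∷ 1 ∷ []
  order4 = ↭-trans (shift 4 (1 ∷ 3 ∷ []) [ 2 ]) (prep 4 (↭-sym (shift 1 (3 ∷ 2 ∷ []) [])))
-- With S = r + 2: the block A has the odd gaps 2r + 5, …, 4r + 5, then 1, then 3, …, 2r + 1, and leaves the
-- two points x₁, x₂ in its middle; after a single point come 2S edges nested around a point, with the even
-- gaps.  Joining x₁ to the single point and x₂ to the last centre supplies the odd gaps 2r + 3 and 4S - 1.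
skolem (suc r) = castPM (size r) gaps ↭-refl (join ↭-refl (join loose (A ⊕ pointPM ⊕ nestedAround (S * 2))))
  where
  S = suc (suc r)
  c = 2 + (r * 2 + 2)
  A = encloseⁿ (suc r) (enclose emptyPM ⊕ encloseⁿ r (pointPM ⊕ pointPM))
  a = suc r * 2 + c
  x₁ = suc r + (2 + (r + 0))
  x₂ = suc r + (2 + (r + 1))
  loose : x₁ ∷ x₂ ∷ a + 0 ∷ a + suc (S * 2) ∷ [] ↭ x₁ ∷ a + 0 ∷ x₂ ∷ a + suc (S * 2) ∷ []
  loose = prep x₁ (swap x₂ (a + 0) ↭-refl)
  size : ∀ r → suc r * 2 + (2 + (r * 2 + 2)) + (1 + suc (suc (suc r) * 2 * 2)) ≡ suc (suc r) * 4 * 2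
  size = solve-∀
  c₁ = suc ((3 + r * 2) * 2)
  c₂ = 3 + r * 2
  gap₁ : absDiff x₂ (a + suc (S * 2)) ≡ c₁
  gap₁ = trans (cong (absDiff x₂) (eq r)) (absDiff-+ʳ x₂ c₁)
    where
    eq : ∀ r → suc r * 2 + (2 + (r * 2 + 2)) + suc (suc (suc r) * 2) ≡ suc ((3 + r * 2) * 2) + (suc r + (2 + (r + 1)))
    eq = solve-∀
  gap₂ : absDiff x₁ (a + 0) ≡ c₂
  gap₂ = trans (cong (absDiff x₁) (eq r)) (absDiff-+ʳ x₁ c₂)
    where
    eq : ∀ r → suc r * 2 + (2 + (r * 2 + 2)) + 0 ≡ 3 + r * 2 + (suc r + (2 + (r + 0)))
    eq = solve-∀
  odds-split : odds (S * 2) ≡ c₁ ∷ nestGaps (suc r) c ++ c₂ ∷ nestGaps r 2 ++ [ 1 ]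
  odds-split = cong (c₁ ∷_) (begin
    odds (3 + r * 2)                                          ≡⟨ cong odds (eq₁ r) ⟩
    odds (suc r + suc (suc r))                                ≡⟨ nestGaps-+ (suc r) (suc (suc r)) 0 ⟩
    nestGaps (suc r) (suc (suc r) * 2) ++ odds (suc (suc r))  ≡⟨ cong₂ (λ d xs → nestGaps (suc r) d ++ c₂ ∷ xs) (eq₂ r)
                                                                       (trans (cong odds (+-comm 1 r)) (nestGaps-+ r 1 0)) ⟩
    nestGaps (suc r) c ++ c₂ ∷ nestGaps r 2 ++ [ 1 ]           ∎)
    where
    open ≡-Reasoning
    eq₁ : ∀ r → 3 + r * 2 ≡ suc r + suc (suc r)
    eq₁ = solve-∀
    eq₂ : ∀ r → suc (suc r) * 2 ≡ 2 + (r * 2 + 2)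
    eq₂ = solve-∀
  gaps : absDiff x₂ (a + suc (S * 2)) ∷ absDiff x₁ (a + 0) ∷ ((nestGaps (suc r) c ++ 1 ∷ (nestGaps r 2 ++ [])) ++ evens (S * 2))
         ↭ positives (suc (suc r) * 4)
  gaps = begin
    absDiff x₂ (a + suc (S * 2)) ∷ absDiff x₁ (a + 0) ∷ ((N ++ 1 ∷ (N′ ++ [])) ++ E)
      ≡⟨ cong₂ (λ d d′ → d ∷ d′ ∷ ((N ++ 1 ∷ (N′ ++ [])) ++ E)) gap₁ gap₂ ⟩
    c₁ ∷ (c₂ ∷ N ++ 1 ∷ (N′ ++ [])) ++ E
      ↭⟨ prep c₁ (++⁺ʳ E (↭-trans (↭-sym (shift c₂ N _)) (++⁺ˡ N (prep c₂ one-last)))) ⟩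
    (c₁ ∷ N ++ c₂ ∷ N′ ++ [ 1 ]) ++ E
      ≡⟨ cong (_++ E) odds-split ⟨
    odds (S * 2) ++ E
      ↭⟨ ++-comm (odds (S * 2)) E ⟩
    E ++ odds (S * 2)
      ↭⟨ evens++odds (S * 2) ⟩
    positives (S * 2 * 2)
      ≡⟨ cong positives (*-assoc S 2 2) ⟩
    positives (S * 4) ∎
    where
    open PermutationReasoning
    N = nestGaps (suc r) c
    N′ = nestGaps r 2
    E = evens (S * 2)
    one-last : 1 ∷ (N′ ++ []) ↭ N′ ++ [ 1 ]
    one-last = ↭-trans (prep 1 (↭-reflexive (++-identityʳ N′))) (∷↭∷ʳ 1 N′)

-- first is placed on the even and second on the odd vertices of K_2size (see interleave)
record TwinMatching (size : ℕ) (gaps : List ℕ) : Set where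
  constructor twin
  field
    {gaps₁ gaps₂} : List ℕ
    first  : PathMatching size gaps₁ []
    second : PathMatching size gaps₂ []
    split  : gaps₁ ++ gaps₂ ↭ gaps

castTM : ∀ {a b D E} → a ≡ b → D ↭ E → TwinMatching a D → TwinMatching b E
castTM refl D↭E (twin X Y s) = twin X Y (↭-trans s D↭E)

infixr 5 _⊗_

_⊗_ : ∀ {a b D E} → TwinMatching a D → TwinMatching b E → TwinMatching (a + b) (D ++ E)
twin {D₁} {D₂} X₁ X₂ s ⊗ twin {E₁} {E₂} Y₁ Y₂ t =
  twin (X₁ ⊕ Y₁) (X₂ ⊕ Y₂) (↭-trans (++-interchange D₁ E₁ D₂ E₂) (++⁺ s t))

twinCopies : ∀ {a D} j → TwinMatching a D → TwinMatching (j * a) (copies j D)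
twinCopies zero X = twin emptyPM emptyPM ↭-refl
twinCopies (suc j) X = X ⊗ twinCopies j X

oddPairGaps : ∀ h → (odds (suc h) ++ odds h) ++ (suc (h + h) ∷ evens h ++ evens h)
                      ↭ positives (suc (h * 2)) ++ positives (suc (h * 2))
oddPairGaps h = begin
  (O₁ ++ O) ++ ((g ∷ E) ++ E)    ↭⟨ ++⁺ʳ _ (++-comm O₁ O) ⟩
  (O ++ O₁) ++ ((g ∷ E) ++ E)    ↭⟨ ++-interchange O O₁ (g ∷ E) E ⟩
  (O ++ g ∷ E) ++ (O₁ ++ E)      ↭⟨ ++-comm (O ++ g ∷ E) _ ⟩
  (O₁ ++ E) ++ (O ++ g ∷ E)      ↭⟨ ++⁺ (odds++evens h) (shift g O E) ⟩
  Pm ++ (g ∷ O ++ E)             ↭⟨ ++⁺ˡ Pm (prep g (↭-trans (++-comm O E) (evens++odds h))) ⟩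
  Pm ++ (g ∷ positives (h * 2))  ≡⟨ cong (λ x → Pm ++ (suc x ∷ positives (h * 2))) (n+n≡n*2 h) ⟩
  Pm ++ Pm                       ∎
  where
  open PermutationReasoning
  O₁ = odds (suc h)
  O = odds h
  E = evens h
  g = suc (h + h)
  Pm = positives (suc (h * 2))

evenPairGaps : ∀ h → odds (suc h) ++ odds (suc h) ++ (suc (suc h + h) ∷ evens (suc h) ++ evens h)
                       ↭ positives (suc h * 2) ++ positives (suc h * 2)
evenPairGaps h = begin
  O₁ ++ (O₁ ++ ((g ∷ E₁) ++ E))        ≡⟨ ++-assoc O₁ O₁ _ ⟨
  (O₁ ++ O₁) ++ ((g ∷ E₁) ++ E)        ↭⟨ ++-comm (O₁ ++ O₁) _ ⟩
  ((g ∷ E₁) ++ E) ++ (O₁ ++ O₁)        ↭⟨ ++-interchange (g ∷ E₁) E O₁ O₁ ⟩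
  g ∷ ((E₁ ++ O₁) ++ (E ++ O₁))        ↭⟨ shift g (E₁ ++ O₁) (E ++ O₁) ⟨
  (E₁ ++ O₁) ++ (g ∷ E ++ O₁)          ↭⟨ ++⁺ (evens++odds (suc h)) (prep g (↭-trans (++-comm E O₁) (odds++evens h))) ⟩
  Pm ++ (g ∷ positives (suc (h * 2)))  ≡⟨ cong (λ x → Pm ++ (suc (suc x) ∷ positives (suc (h * 2)))) (n+n≡n*2 h) ⟩
  Pm ++ Pm                             ∎
  where
  open PermutationReasoning
  O₁ = odds (suc h)
  E₁ = evens (suc h)
  E = evens h
  g = suc (suc h + h)
  Pm = positives (suc h * 2)

twinPairs : ∀ m → TwinMatching (m * 2) (copies 2 (positives m))
twinPairs m with parity m
... | even zero = twin emptyPM emptyPM ↭-refl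
... | odd h =
  castTM refl (↭-reflexive (cong (Pm ++_) (sym (++-identityʳ Pm))))
    (twin (resize (size₁ h) (nested (suc h) ⊕ nested h)) (resize (size₂ h) (bridged h h)) (oddPairGaps h))
  where
  Pm = positives (suc (h * 2))
  size₁ : ∀ h → suc h * 2 + h * 2 ≡ suc (h * 2) * 2
  size₁ = solve-∀
  size₂ : ∀ h → suc (h * 2) + suc (h * 2) ≡ suc (h * 2) * 2
  size₂ = solve-∀
... | even (suc h) =
  castTM refl (↭-reflexive (cong (Pm ++_) (sym (++-identityʳ Pm))))
    (twin (resize (size₁ h) (nested (suc h) ⊕ nested (suc h))) (resize (size₂ h) (bridged (suc h) h))
          (↭-trans (↭-reflexive (++-assoc (odds (suc h)) _ _)) (evenPairGaps h)))
  where
  Pm = positives (suc h * 2)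
  size₁ : ∀ h → suc h * 2 + suc h * 2 ≡ suc h * 2 * 2
  size₁ = solve-∀
  size₂ : ∀ h → suc (suc h * 2) + suc (h * 2) ≡ suc h * 2 * 2
  size₂ = solve-∀

twinTriples : ∀ {m} h → m ≡ suc h * 2 → PathMatching (m * 2) (positives m) [] →
              TwinMatching (m * 3) (copies 3 (positives m))
twinTriples h refl Sk =
  twin (resize (size₁ h) (Sk ⊕ nested (suc h))) (resize (size₂ h) (nested (suc h) ⊕ bridged (suc h) h))
    (↭-trans (↭-reflexive (++-assoc Pm _ _))
             (++⁺ˡ Pm (↭-trans (evenPairGaps h) (++⁺ˡ Pm (↭-reflexive (sym (++-identityʳ Pm)))))))
  where
  Pm = positives (suc h * 2)
  size₁ : ∀ h → suc h * 2 * 2 + suc h * 2 ≡ suc h * 2 * 3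
  size₁ = solve-∀
  size₂ : ∀ h → suc h * 2 + (suc (suc h * 2) + suc (h * 2)) ≡ suc h * 2 * 3
  size₂ = solve-∀

evenMultiplicityTwin : ∀ m j → TwinMatching (m * (j * 2)) (copies (j * 2) (positives m))
evenMultiplicityTwin m j =
  castTM (size m j) (↭-reflexive (sym (copies-* j 2 (positives m)))) (twinCopies j (twinPairs m))
  where
  size : ∀ m j → j * (m * 2) ≡ m * (j * 2)
  size = solve-∀

oddMultiplicityTwin : ∀ s j → TwinMatching (suc s * 4 * (3 + j * 2)) (copies (3 + j * 2) (positives (suc s * 4)))
oddMultiplicityTwin s j =
  castTM (size s j) (↭-reflexive gaps) (twinTriples (suc (s * 2)) (m-even s) (skolem s) ⊗ twinCopies j (twinPairs m))
  where
  m = suc s * 4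
  Pm = positives m
  m-even : ∀ s → suc s * 4 ≡ suc (suc (s * 2)) * 2
  m-even = solve-∀
  size : ∀ s j → suc s * 4 * 3 + j * (suc s * 4 * 2) ≡ suc s * 4 * (3 + j * 2)
  size = solve-∀
  gaps : copies 3 Pm ++ copies j (copies 2 Pm) ≡ copies (3 + j * 2) Pm
  gaps = trans (cong (copies 3 Pm ++_) (sym (copies-* j 2 Pm))) (sym (copies-+ 3 (j * 2) Pm))

-- Perfect matchings of K_2n

Unique-resp-↭ : ∀ {xs ys : List ℕ} → xs ↭ ys → Unique xs → Unique ys
Unique-resp-↭ p = SetoidPermutation.Unique-resp-↭ (setoid ℕ) (↭⇒↭ₛ p)

unique-covering⇒↭upTo : ∀ N (xs : List ℕ) → Unique xs → All (_< N) xs → (∀ x → x < N → x ∈ xs) → xs ↭ upTo N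
unique-covering⇒↭upTo zero [] _ _ _ = ↭-refl
unique-covering⇒↭upTo zero (x ∷ xs) _ (() ∷ _) _
unique-covering⇒↭upTo (suc N) xs unique bounded covering with ∈-∃++ (covering N ≤-refl)
... | ys , zs , refl = begin
  ys ++ [ N ] ++ zs  ↭⟨ moved ⟩
  N ∷ ys ++ zs       ↭⟨ prep N (unique-covering⇒↭upTo N (ys ++ zs) (AllPairs.tail moved-unique) rest-bounded rest-covering) ⟩
  N ∷ upTo N         ↭⟨ ∷↭∷ʳ N (upTo N) ⟩
  upTo N ++ [ N ]    ≡⟨ upTo-∷ʳ N ⟩
  upTo (suc N)       ∎
  where
  open PermutationReasoning
  moved : ys ++ [ N ] ++ zs ↭ N ∷ (ys ++ zs)
  moved = shift N ys zs
  moved-unique : Unique (N ∷ ys ++ zs)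
  moved-unique = Unique-resp-↭ moved unique
  rest-bounded : All (_< N) (ys ++ zs)
  rest-bounded = All.zipWith (λ (N≢x , x<1+N) → ≤∧≢⇒< (≤-pred x<1+N) (N≢x ∘ sym))
                             (AllPairs.head moved-unique , All.tail (All-resp-↭ moved bounded))
  rest-covering : ∀ x → x < N → x ∈ ys ++ zs
  rest-covering x x<N with ∈-resp-↭ moved (covering x (m≤n⇒m≤1+n x<N))
  ... | here refl = ⊥-elim (<-irrefl refl x<N)
  ... | there x∈ = x∈

length-endpoints : ∀ F → length (endpoints F) ≡ 2 * length F
length-endpoints [] = refl
length-endpoints ((u , w) ∷ F) = trans (cong (2 +_) (length-endpoints F)) (sym (*-suc 2 (length F)))

edges⇒bounded : ∀ N F → All (IsEdge N) F → All (_< N) (endpoints F)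
edges⇒bounded N [] [] = []
edges⇒bounded N ((u , w) ∷ F) ((u< , w< , _) ∷ es) = u< ∷ w< ∷ edges⇒bounded N F es

bounded-unique⇒edges : ∀ N F → Unique (endpoints F) → All (_< N) (endpoints F) → All (IsEdge N) F
bounded-unique⇒edges N [] _ _ = []
bounded-unique⇒edges N ((u , w) ∷ F) ((u≢w ∷ _) ∷ (_ ∷ unique)) (u< ∷ w< ∷ bounded) =
  (u< , w< , u≢w) ∷ bounded-unique⇒edges N F unique bounded

perfect⇔endpoints↭upTo : ∀ n F → IsPerfectMatching n F ⇔ (endpoints F ↭ upTo (2 * n))
perfect⇔endpoints↭upTo n F = mk⇔ to from
  where
  to : IsPerfectMatching n F → endpoints F ↭ upTo (2 * n)
  to (edges , _ , unique , covering) =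
    unique-covering⇒↭upTo (2 * n) (endpoints F) unique (edges⇒bounded (2 * n) F edges) covering
  from : endpoints F ↭ upTo (2 * n) → IsPerfectMatching n F
  from p = bounded-unique⇒edges (2 * n) F unique bounded , size , unique , covering
    where
    unique : Unique (endpoints F)
    unique = Unique-resp-↭ (↭-sym p) (upTo⁺ (2 * n))
    bounded : All (_< 2 * n) (endpoints F)
    bounded = All.tabulate (λ x∈ → ∈-upTo⁻ (∈-resp-↭ p x∈))
    size : length F ≡ n
    size = *-cancelˡ-≡ (length F) n 2 (trans (sym (length-endpoints F)) (trans (↭-length p) (length-upTo (2 * n))))
    covering : ∀ x → x < 2 * n → x ∈ endpoints F
    covering x x< = ∈-resp-↭ (↭-sym p) (∈-upTo⁺ x<)

edgeLength-short : ∀ N e → gap e + gap e ≤ N → edgeLength N e ≡ gap e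
edgeLength-short N (u , w) short = m≤n⇒m⊓n≡m (m+n≤o⇒m≤o∸n (absDiff u w) short)

lengths-doubled : ∀ {n} f → (∀ e → gap (mapEdge f e) ≡ 2 * gap e) →
                  ∀ F → All (λ e → gap e + gap e ≤ n) F → lengths (2 * n) (map (mapEdge f) F) ≡ map (2 *_) (map gap F)
lengths-doubled f gap-f [] [] = refl
lengths-doubled {n} f gap-f (e ∷ F) (short ∷ shorts) = cong₂ _∷_ length-e (lengths-doubled f gap-f F shorts)
  where
  doubled-short : 2 * gap e + 2 * gap e ≤ 2 * n
  doubled-short = ≤-trans (≤-reflexive (sym (*-distribˡ-+ 2 (gap e) (gap e)))) (*-monoʳ-≤ 2 short)
  length-e : edgeLength (2 * n) (mapEdge f e) ≡ 2 * gap e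
  length-e = trans (edgeLength-short (2 * n) (mapEdge f e) (subst (λ g → g + g ≤ 2 * n) (sym (gap-f e)) doubled-short))
                   (gap-f e)

interleave : ∀ {n D} → TwinMatching n D → All (λ d → d + d ≤ n) D →
             Σ (List Edge) λ F → IsPerfectMatching n F × (lengths (2 * n) F ↭ map (2 *_) D)
interleave {n} {D} (twin {D₁} {D₂} (pathMatching F₁ cov₁ gs₁) (pathMatching F₂ cov₂ gs₂) split) short =
  F , Equivalence.from (perfect⇔endpoints↭upTo n F) covers , lengths↭
  where
  F = map (mapEdge (2 *_)) F₁ ++ map (mapEdge (suc ∘ (2 *_))) F₂
  covers : endpoints F ↭ upTo (2 * n)
  covers = begin
    endpoints F
      ≡⟨ trans (endpoints-++ (map (mapEdge (2 *_)) F₁) _)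
               (cong₂ _++_ (endpoints-map (2 *_) F₁) (endpoints-map (suc ∘ (2 *_)) F₂)) ⟩
    map (2 *_) (endpoints F₁) ++ map (suc ∘ (2 *_)) (endpoints F₂)
      ↭⟨ ++⁺ (map⁺ _ (↭-trans (↭-reflexive (sym (++-identityʳ _))) cov₁))
             (map⁺ _ (↭-trans (↭-reflexive (sym (++-identityʳ _))) cov₂)) ⟩
    map (2 *_) (upTo n) ++ map (suc ∘ (2 *_)) (upTo n)
      ↭⟨ upTo-2* n ⟨
    upTo (2 * n) ∎
    where open PermutationReasoning
  short₁₂ : All (λ d → d + d ≤ n) (D₁ ++ D₂)
  short₁₂ = All-resp-↭ (↭-sym split) short
  shortEdges : ∀ {G Dᵢ} → map gap G ↭ Dᵢ → All (λ d → d + d ≤ n) Dᵢ → All (λ e → gap e + gap e ≤ n) G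
  shortEdges gs shortDᵢ = All.map⁻ (All-resp-↭ (↭-sym gs) shortDᵢ)
  lengths↭ : lengths (2 * n) F ↭ map (2 *_) D
  lengths↭ = begin
    lengths (2 * n) F
      ≡⟨ map-++ (edgeLength (2 * n)) (map (mapEdge (2 *_)) F₁) _ ⟩
    lengths (2 * n) (map (mapEdge (2 *_)) F₁) ++ lengths (2 * n) (map (mapEdge (suc ∘ (2 *_))) F₂)
      ≡⟨ cong₂ _++_ (lengths-doubled (2 *_) gap-double F₁ (shortEdges gs₁ (All.++⁻ˡ D₁ short₁₂)))
                    (lengths-doubled (suc ∘ (2 *_)) gap-doubleSuc F₂ (shortEdges gs₂ (All.++⁻ʳ D₁ short₁₂))) ⟩
    map (2 *_) (map gap F₁) ++ map (2 *_) (map gap F₂)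
      ↭⟨ ++⁺ (map⁺ _ gs₁) (map⁺ _ gs₂) ⟩
    map (2 *_) D₁ ++ map (2 *_) D₂
      ≡⟨ map-++ (2 *_) D₁ D₂ ⟨
    map (2 *_) (D₁ ++ D₂)
      ↭⟨ map⁺ _ split ⟩
    map (2 *_) D ∎
    where open PermutationReasoning

evenList-suc : ∀ t m → evenList t (suc m) ≡ evenList t m ++ replicate t (2 * suc m)
evenList-suc t m = begin
  concat (map f (upTo (suc m)))       ≡⟨ cong (concat ∘ map f) (upTo-∷ʳ m) ⟨
  concat (map f (upTo m ++ [ m ]))    ≡⟨ cong concat (map-++ f (upTo m) [ m ]) ⟩
  concat (map f (upTo m) ++ [ f m ])  ≡⟨ concat-++ (map f (upTo m)) [ f m ] ⟨
  evenList t m ++ (f m ++ [])         ≡⟨ cong (evenList t m ++_) (++-identityʳ (f m)) ⟩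
  evenList t m ++ f m                 ∎
  where
  open ≡-Reasoning
  f = λ i → replicate t (2 * suc i)

doubledCopies↭evenList : ∀ t m → map (2 *_) (copies t (positives m)) ↭ evenList t m
doubledCopies↭evenList t zero = ↭-reflexive (cong (map (2 *_)) (copies-[] t))
doubledCopies↭evenList t (suc m) = begin
  map (2 *_) (copies t (suc m ∷ Pm))                     ↭⟨ map⁺ (2 *_) (copies-∷ t (suc m) Pm) ⟩
  map (2 *_) (replicate t (suc m) ++ copies t Pm)        ≡⟨ map-++ (2 *_) (replicate t (suc m)) _ ⟩
  map (2 *_) (replicate t (suc m)) ++ map (2 *_) (copies t Pm)
                                                         ≡⟨ cong (_++ map (2 *_) (copies t Pm)) (map-replicate (2 *_) t (suc m)) ⟩
  replicate t (2 * suc m) ++ map (2 *_) (copies t Pm)    ↭⟨ ++⁺ˡ _ (doubledCopies↭evenList t m) ⟩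
  replicate t (2 * suc m) ++ evenList t m                ↭⟨ ++-comm (replicate t (2 * suc m)) _ ⟩
  evenList t m ++ replicate t (2 * suc m)                ≡⟨ evenList-suc t m ⟨
  evenList t (suc m)                                     ∎
  where
  open PermutationReasoning
  Pm = positives m

twin⇒targetMatching : ∀ {n m} k → n ≡ m * suc (suc k) →
                      TwinMatching (m * suc (suc k)) (copies (suc (suc k)) (positives m)) →
                      Σ (List Edge) λ F → IsPerfectMatching n F × (lengths (2 * n) F ↭ targetList (suc (suc k)) n)
twin⇒targetMatching {m = m} k refl X =
  let F , perfect , lengths↭ = interleave X short in
  F , perfect , ↭-trans lengths↭ (↭-trans (doubledCopies↭evenList t m) (↭-reflexive (cong (evenList t) (sym (m*n/n≡m m t)))))
  where
  t = suc (suc k)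
  m+m≤m*t : m + m ≤ m * t
  m+m≤m*t = ≤-trans (≤-reflexive (n+n≡n*2 m)) (*-monoʳ-≤ m (s≤s (s≤s z≤n)))
  short : All (λ d → d + d ≤ m * t) (copies t (positives m))
  short = All.map (λ d≤m → ≤-trans (+-mono-≤ d≤m d≤m) m+m≤m*t) (copies-bounded t m)

-- Necessity

parityBit : ℕ → ℕ
parityBit 0 = 0
parityBit 1 = 1
parityBit (suc (suc x)) = parityBit x

parityBit[m*2+n]≡parityBit[n] : ∀ m n → parityBit (m * 2 + n) ≡ parityBit n
parityBit[m*2+n]≡parityBit[n] zero n = refl
parityBit[m*2+n]≡parityBit[n] (suc m) n = parityBit[m*2+n]≡parityBit[n] m n

⌊m*2+n/2⌋≡m+⌊n/2⌋ : ∀ m n → ⌊ m * 2 + n /2⌋ ≡ m + ⌊ n /2⌋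
⌊m*2+n/2⌋≡m+⌊n/2⌋ zero n = refl
⌊m*2+n/2⌋≡m+⌊n/2⌋ (suc m) n = cong suc (⌊m*2+n/2⌋≡m+⌊n/2⌋ m n)

⌊n*2/2⌋≡n : ∀ n → ⌊ n * 2 /2⌋ ≡ n
⌊n*2/2⌋≡n zero = refl
⌊n*2/2⌋≡n (suc n) = cong suc (⌊n*2/2⌋≡n n)

edgeLength-comm : ∀ N u w → edgeLength N (u , w) ≡ edgeLength N (w , u)
edgeLength-comm N u w = cong (λ d → d ⊓ (N ∸ d)) (absDiff-comm u w)

absDiff+≡ : ∀ {u w} → u ≤ w → absDiff u w + u ≡ w
absDiff+≡ {u} {w} u≤w = trans (cong (λ x → x + (w ∸ u) + u) (m≤n⇒m∸n≡0 u≤w)) (m∸n+n≡m u≤w)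

absDiff≤ : ∀ {u w} → u ≤ w → absDiff u w ≤ w
absDiff≤ {u} {w} u≤w = ≤-trans (m≤m+n (absDiff u w) u) (≤-reflexive (absDiff+≡ u≤w))

complement-half : ∀ {n d f} → f * 2 + d ≡ n * 2 → Σ ℕ λ e → d ≡ e * 2 × f + e ≡ n
complement-half {n} {d} {f} eq with ∣m+n∣m⇒∣n (divides n eq) (divides f refl)
... | divides e d≡e*2 = e , d≡e*2 , *-cancelʳ-≡ (f + e) n 2 (begin
  (f + e) * 2    ≡⟨ *-distribʳ-+ 2 f e ⟩
  f * 2 + e * 2  ≡⟨ cong (f * 2 +_) d≡e*2 ⟨
  f * 2 + d      ≡⟨ eq ⟩
  n * 2          ∎)
  where open ≡-Reasoning

-- With d = w - u the length ℓ is d or 2n - d; writing d = 2e and ℓ = 2f this is f = e or f + e = n.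
evenLength-shape : ∀ {n u w} → u ≤ w → w < 2 * n → 2 ∣ edgeLength (2 * n) (u , w) →
                   Σ ℕ λ e → Σ ℕ λ f → w ≡ e * 2 + u × edgeLength (2 * n) (u , w) ≡ f * 2 × (f ≡ e ⊎ f + e ≡ n)
evenLength-shape {n} {u} {w} u≤w w<2n (divides f ℓ≡f*2) with ⊓-sel (absDiff u w) (2 * n ∸ absDiff u w)
... | inj₁ ℓ≡d = f , f , trans (sym (absDiff+≡ u≤w)) (cong (_+ u) (trans (sym ℓ≡d) ℓ≡f*2)) , ℓ≡f*2 , inj₁ refl
... | inj₂ ℓ≡2n∸d =
  let e , d≡e*2 , f+e≡n = complement-half {n} {absDiff u w} {f} f*2+d≡n*2
  in e , f , trans (sym (absDiff+≡ u≤w)) (cong (_+ u) d≡e*2) , ℓ≡f*2 , inj₂ f+e≡n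
  where
  f*2+d≡n*2 : f * 2 + absDiff u w ≡ n * 2
  f*2+d≡n*2 = trans (cong (_+ absDiff u w) (trans (sym ℓ≡f*2) ℓ≡2n∸d))
                    (trans (m∸n+n≡m (≤-trans (absDiff≤ u≤w) (<⇒≤ w<2n))) (*-comm 2 n))

onEnds : (ℕ → ℕ) → Edge → ℕ
onEnds g (u , w) = g u + g w

EvenEdgeInvariants : ℕ → Edge → Set
EvenEdgeInvariants n (u , w) =
  parityBit u ≡ parityBit w × (2 ∣ n → 2 ∣ onEnds ⌊_/2⌋ (u , w) + ⌊ edgeLength (2 * n) (u , w) /2⌋)

even-e+f : ∀ {n e f} → 2 ∣ n → f ≡ e ⊎ f + e ≡ n → 2 ∣ e + f
even-e+f {e = e} _ (inj₁ refl) = divides e (n+n≡n*2 e)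
even-e+f {e = e} {f} 2∣n (inj₂ f+e≡n) = subst (2 ∣_) (trans (sym f+e≡n) (+-comm f e)) 2∣n

ordered-evenEdge-invariants : ∀ {n u w} → u ≤ w → w < 2 * n → 2 ∣ edgeLength (2 * n) (u , w) →
                              EvenEdgeInvariants n (u , w)
ordered-evenEdge-invariants {n} {u} u≤w w< ℓ-even with evenLength-shape {n} u≤w w< ℓ-even
... | e , f , refl , ℓ≡f*2 , f≡e⊎f+e≡n =
  sym (parityBit[m*2+n]≡parityBit[n] e u) ,
  λ 2∣n → subst (2 ∣_) (sym half-sum) (∣m∣n⇒∣m+n (divides ⌊ u /2⌋ refl) (even-e+f {n} 2∣n f≡e⊎f+e≡n))
  where
  regroup : ∀ h e f → h + (e + h) + f ≡ h * 2 + (e + f)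
  regroup = solve-∀
  half-sum : ⌊ u /2⌋ + ⌊ e * 2 + u /2⌋ + ⌊ edgeLength (2 * n) (u , e * 2 + u) /2⌋ ≡ ⌊ u /2⌋ * 2 + (e + f)
  half-sum = trans (cong₂ (λ x y → ⌊ u /2⌋ + x + y)
                          (⌊m*2+n/2⌋≡m+⌊n/2⌋ e u) (trans (cong ⌊_/2⌋ ℓ≡f*2) (⌊n*2/2⌋≡n f)))
                   (regroup ⌊ u /2⌋ e f)

evenEdge-invariants : ∀ n u w → u < 2 * n → w < 2 * n → 2 ∣ edgeLength (2 * n) (u , w) → EvenEdgeInvariants n (u , w)
evenEdge-invariants n u w u< w< ℓ-even with ≤-total u w
... | inj₁ u≤w = ordered-evenEdge-invariants u≤w w< ℓ-even
... | inj₂ w≤u with ordered-evenEdge-invariants w≤u u< (subst (2 ∣_) (edgeLength-comm (2 * n) u w) ℓ-even)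
...   | same , halves =
  sym same ,
  λ 2∣n → subst (2 ∣_) (cong₂ _+_ (+-comm ⌊ w /2⌋ ⌊ u /2⌋) (cong ⌊_/2⌋ (edgeLength-comm (2 * n) w u))) (halves 2∣n)

sum-even : ∀ {xs} → All (2 ∣_) xs → 2 ∣ sum xs
sum-even [] = divides 0 refl
sum-even (2∣x ∷ 2∣xs) = ∣m∣n⇒∣m+n 2∣x (sum-even 2∣xs)

sum-map-+ : ∀ {A : Set} (f g : A → ℕ) xs → sum (map (λ x → f x + g x) xs) ≡ sum (map f xs) + sum (map g xs)
sum-map-+ f g [] = refl
sum-map-+ f g (x ∷ xs) = trans (cong (f x + g x +_) (sum-map-+ f g xs)) (interchange (f x) (g x) _ _)
  where
  interchange : ∀ a b c d → a + b + (c + d) ≡ a + c + (b + d)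
  interchange = solve-∀

sum-copies : ∀ t xs → sum (copies t xs) ≡ t * sum xs
sum-copies zero xs = refl
sum-copies (suc t) xs = trans (sum-++ xs (copies t xs)) (cong (sum xs +_) (sum-copies t xs))

sum-endpoints : ∀ g F → sum (map g (endpoints F)) ≡ sum (map (onEnds g) F)
sum-endpoints g [] = refl
sum-endpoints g ((u , w) ∷ F) = trans (sym (+-assoc (g u) (g w) _)) (cong (g u + g w +_) (sum-endpoints g F))

sum-vertices : ∀ g {n F} → IsPerfectMatching n F → sum (map (onEnds g) F) ≡ sum (map g (upTo (2 * n)))
sum-vertices g {n} {F} perfect =
  trans (sym (sum-endpoints g F)) (sum-↭ (map⁺ g (Equivalence.to (perfect⇔endpoints↭upTo n F) perfect)))

sum-upTo-2*suc : ∀ g n → sum (map g (upTo (2 * suc n))) ≡ sum (map g (upTo (2 * n))) + (g (2 * n) + g (suc (2 * n)))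
sum-upTo-2*suc g n = begin
  sum (map g (upTo (2 * suc n)))                                     ≡⟨ cong (sum ∘ map g) (upTo-2*suc n) ⟩
  sum (map g (upTo (2 * n) ++ 2 * n ∷ suc (2 * n) ∷ []))             ≡⟨ cong sum (map-++ g (upTo (2 * n)) _) ⟩
  sum (map g (upTo (2 * n)) ++ g (2 * n) ∷ g (suc (2 * n)) ∷ [])     ≡⟨ sum-++ (map g (upTo (2 * n))) _ ⟩
  sum (map g (upTo (2 * n))) + (g (2 * n) + (g (suc (2 * n)) + 0))  ≡⟨ cong (λ x → sum (map g (upTo (2 * n))) + (g (2 * n) + x))
                                                                              (+-identityʳ _) ⟩
  sum (map g (upTo (2 * n))) + (g (2 * n) + g (suc (2 * n)))         ∎
  where open ≡-Reasoning

b+2*n≡n*2+b : ∀ n b → b + 2 * n ≡ n * 2 + b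
b+2*n≡n*2+b = solve-∀

parityBit[2*n]≡0 : ∀ n → parityBit (2 * n) ≡ 0
parityBit[2*n]≡0 n = trans (cong parityBit (b+2*n≡n*2+b n 0)) (parityBit[m*2+n]≡parityBit[n] n 0)

parityBit[1+2*n]≡1 : ∀ n → parityBit (suc (2 * n)) ≡ 1
parityBit[1+2*n]≡1 n = trans (cong parityBit (b+2*n≡n*2+b n 1)) (parityBit[m*2+n]≡parityBit[n] n 1)

⌊2*n/2⌋≡n : ∀ n → ⌊ 2 * n /2⌋ ≡ n
⌊2*n/2⌋≡n n = trans (cong ⌊_/2⌋ (*-comm 2 n)) (⌊n*2/2⌋≡n n)

⌊1+2*n/2⌋≡n : ∀ n → ⌊ suc (2 * n) /2⌋ ≡ n
⌊1+2*n/2⌋≡n n = trans (cong ⌊_/2⌋ (b+2*n≡n*2+b n 1)) (trans (⌊m*2+n/2⌋≡m+⌊n/2⌋ n 1) (+-identityʳ n))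

sum-parityBit : ∀ n → sum (map parityBit (upTo (2 * n))) ≡ n
sum-parityBit zero = refl
sum-parityBit (suc n) = begin
  sum (map parityBit (upTo (2 * suc n)))                                       ≡⟨ sum-upTo-2*suc parityBit n ⟩
  sum (map parityBit (upTo (2 * n))) + (parityBit (2 * n) + parityBit (suc (2 * n)))
                                     ≡⟨ cong₂ _+_ (sum-parityBit n) (cong₂ _+_ (parityBit[2*n]≡0 n) (parityBit[1+2*n]≡1 n)) ⟩
  n + 1                                                                        ≡⟨ +-comm n 1 ⟩
  suc n                                                                        ∎
  where open ≡-Reasoning

even-sum-halves : ∀ n → 2 ∣ sum (map ⌊_/2⌋ (upTo (2 * n)))
even-sum-halves zero = divides 0 refl
even-sum-halves (suc n) =
  subst (2 ∣_) (sym (sum-upTo-2*suc ⌊_/2⌋ n)) (∣m∣n⇒∣m+n (even-sum-halves n) (divides n last-pair))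
  where
  last-pair : ⌊ 2 * n /2⌋ + ⌊ suc (2 * n) /2⌋ ≡ n * 2
  last-pair = trans (cong₂ _+_ (⌊2*n/2⌋≡n n) (⌊1+2*n/2⌋≡n n)) (n+n≡n*2 n)

evenEdges : ∀ {n F} → IsPerfectMatching n F → All (2 ∣_) (lengths (2 * n) F) → All (EvenEdgeInvariants n) F
evenEdges {n} (edges , _) 2∣ℓs =
  All.zipWith (λ { {u , w} ((u< , w< , _) , ℓ-even) → evenEdge-invariants n u w u< w< ℓ-even }) (edges , All.map⁻ 2∣ℓs)

evenLengths⇒even : ∀ {n F} → IsPerfectMatching n F → All (2 ∣_) (lengths (2 * n) F) → 2 ∣ n
evenLengths⇒even {n} {F} perfect 2∣ℓs =
  subst (2 ∣_) (trans (sum-vertices parityBit perfect) (sum-parityBit n))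
        (sum-even (All.map⁺ (All.map (λ { {u , w} (same , _) → even-ends {u} {w} same }) (evenEdges perfect 2∣ℓs))))
  where
  even-ends : ∀ {u w} → parityBit u ≡ parityBit w → 2 ∣ parityBit u + parityBit w
  even-ends {u} same = subst (λ x → 2 ∣ parityBit u + x) same (divides (parityBit u) (n+n≡n*2 (parityBit u)))

evenLengths⇒evenHalfSum : ∀ {n F} → IsPerfectMatching n F → All (2 ∣_) (lengths (2 * n) F) →
                           2 ∣ sum (map ⌊_/2⌋ (lengths (2 * n) F))
evenLengths⇒evenHalfSum {n} {F} perfect 2∣ℓs =
  subst (2 ∣_) (cong sum (map-∘ F))
    (∣m+n∣m⇒∣n (subst (2 ∣_) (sum-map-+ (onEnds ⌊_/2⌋) (λ e → ⌊ edgeLength (2 * n) e /2⌋) F) per-edge)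
               (subst (2 ∣_) (sym (sum-vertices ⌊_/2⌋ perfect)) (even-sum-halves n)))
  where
  per-edge : 2 ∣ sum (map (λ e → onEnds ⌊_/2⌋ e + ⌊ edgeLength (2 * n) e /2⌋) F)
  per-edge = sum-even (All.map⁺ (All.map (λ inv → proj₂ inv (evenLengths⇒even perfect 2∣ℓs)) (evenEdges perfect 2∣ℓs)))

2∣[1+k*2]*x⇒2∣x : ∀ k x → 2 ∣ suc (k * 2) * x → 2 ∣ x
2∣[1+k*2]*x⇒2∣x k x 2∣ = ∣m+n∣m⇒∣n (subst (2 ∣_) (+-comm x (k * 2 * x)) 2∣) (divides (k * x) (regroup k x))
  where
  regroup : ∀ k x → k * 2 * x ≡ k * x * 2
  regroup = solve-∀

sum-positives : ∀ r → sum (positives (r * 2)) ≡ r * suc (r * 2)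
sum-positives zero = refl
sum-positives (suc r) = trans (cong (λ x → suc (suc (r * 2)) + (suc (r * 2) + x)) (sum-positives r)) (step r)
  where
  step : ∀ r → suc (suc (r * 2)) + (suc (r * 2) + r * suc (r * 2)) ≡ suc r * suc (suc r * 2)
  step = solve-∀

parities⇒4∣m : ∀ k m → 2 ∣ m * suc (k * 2) → 2 ∣ suc (k * 2) * sum (positives m) → 4 ∣ m
parities⇒4∣m k m 2∣mt 2∣t∑ with 2∣[1+k*2]*x⇒2∣x k m (subst (2 ∣_) (*-comm m (suc (k * 2))) 2∣mt)
... | divides r refl with 2∣[1+k*2]*x⇒2∣x r r (subst (2 ∣_) (trans (sum-positives r) (*-comm r _))
                                                           (2∣[1+k*2]*x⇒2∣x k _ 2∣t∑))
...   | divides q refl = divides q (*-assoc q 2 2)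

sum-halves-doubled : ∀ xs → sum (map ⌊_/2⌋ (map (2 *_) xs)) ≡ sum xs
sum-halves-doubled [] = refl
sum-halves-doubled (x ∷ xs) = cong₂ _+_ (⌊2*n/2⌋≡n x) (sum-halves-doubled xs)

oddCopies⇒4∣ : ∀ {n m F} k → IsPerfectMatching n F → lengths (2 * n) F ↭ evenList (suc (k * 2)) m →
               n ≡ m * suc (k * 2) → 4 ∣ m
oddCopies⇒4∣ {n} {m} {F} k perfect ℓ↭ refl =
  parities⇒4∣m k m (evenLengths⇒even perfect 2∣ℓs) (subst (2 ∣_) half-sum (evenLengths⇒evenHalfSum perfect 2∣ℓs))
  where
  t = suc (k * 2)
  doubled : lengths (2 * n) F ↭ map (2 *_) (copies t (positives m))
  doubled = ↭-trans ℓ↭ (↭-sym (doubledCopies↭evenList t m))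
  2∣ℓs : All (2 ∣_) (lengths (2 * n) F)
  2∣ℓs = All-resp-↭ (↭-sym doubled) (All.map⁺ (All.universal (λ x → divides x (*-comm 2 x)) _))
  half-sum : sum (map ⌊_/2⌋ (lengths (2 * n) F)) ≡ t * sum (positives m)
  half-sum = begin
    sum (map ⌊_/2⌋ (lengths (2 * n) F))                       ≡⟨ sum-↭ (map⁺ ⌊_/2⌋ doubled) ⟩
    sum (map ⌊_/2⌋ (map (2 *_) (copies t (positives m))))      ≡⟨ sum-halves-doubled (copies t (positives m)) ⟩
    sum (copies t (positives m))                              ≡⟨ sum-copies t (positives m) ⟩
    t * sum (positives m)                                     ∎
    where open ≡-Reasoning

sOf-even : ∀ h → sOf (h * 2) ≡ h * 2
sOf-even h with h * 2 % 2 | m*n%n≡0 h 2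
... | _ | refl = refl

sOf-odd : ∀ h → sOf (suc (h * 2)) ≡ 4 * suc (h * 2)
sOf-odd h with suc (h * 2) % 2 | [m+kn]%n≡m%n 1 h 2
... | _ | refl = refl

Realisable : ℕ → ℕ → Set
Realisable n t = (t ∣ n) × Σ (List Edge) (λ F → IsPerfectMatching n F × (lengths (2 * n) F ↭ targetList t n))

evenMultiplicity-realisable : ∀ n j → Realisable n (suc j * 2) ⇔ (sOf (suc j * 2) ∣ n)
evenMultiplicity-realisable n j = mk⇔ (λ (t∣n , _) → subst (_∣ n) (sym (sOf-even (suc j))) t∣n) realise
  where
  realise : sOf (suc j * 2) ∣ n → Realisable n (suc j * 2)
  realise s∣n with subst (_∣ n) (sOf-even (suc j)) s∣n
  ... | divides m n≡m*t = divides m n≡m*t , twin⇒targetMatching {m = m} (j * 2) n≡m*t (evenMultiplicityTwin m (suc j))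

oddMultiplicity-realisable : ∀ n j → 1 ≤ n → Realisable n (suc (suc j * 2)) ⇔ (sOf (suc (suc j * 2)) ∣ n)
oddMultiplicity-realisable n j 1≤n = mk⇔ necessary sufficient
  where
  t = suc (suc j * 2)
  necessary : Realisable n t → sOf t ∣ n
  necessary (divides m n≡m*t , F , perfect , ℓ↭) =
    subst₂ _∣_ (sym (sOf-odd (suc j))) (sym n≡m*t) (*-monoˡ-∣ t (oddCopies⇒4∣ {m = m} (suc j) perfect ℓ↭′ n≡m*t))
    where
    ℓ↭′ : lengths (2 * n) F ↭ evenList t m
    ℓ↭′ = ↭-trans ℓ↭ (↭-reflexive (cong (evenList t) (trans (cong (_/ t) n≡m*t) (m*n/n≡m m t))))
  sufficient : sOf t ∣ n → Realisable n t
  sufficient s∣n with subst (_∣ n) (sOf-odd (suc j)) s∣n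
  ... | divides zero n≡0 = ⊥-elim (n≮0 (subst (1 ≤_) n≡0 1≤n))
  ... | divides (suc s) n≡ = divides m n≡m*t , twin⇒targetMatching {m = m} (suc (j * 2)) n≡m*t (oddMultiplicityTwin s j)
    where
    m = suc s * 4
    n≡m*t : n ≡ m * t
    n≡m*t = trans n≡ (sym (*-assoc (suc s) 4 t))

proposition4p6 : (n t : ℕ) → 1 ≤ n → 2 ≤ t →
    ((t ∣ n) × Σ (List Edge) (λ F → IsPerfectMatching n F × (lengths (2 * n) F ↭ targetList t n)))
      ⇔ (sOf t ∣ n)
proposition4p6 n t 1≤n 2≤t with parity t | 2≤t
... | even zero    | ()
... | odd zero     | s≤s ()
... | even (suc j) | _ = evenMultiplicity-realisable n j
... | odd (suc j)  | _ = oddMultiplicity-realisable n j 1≤n
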